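{- Let $\Sigma$ be a finite alphabet, $k\in\mathbb{N}$, and $w,\tilde w\in\Sigma^*$ with $\iota(w)=\iota(\tilde w)=1$, with $\alpha$-$\beta$-factorizations $w=\alpha_0\beta_1\alpha_1$ and $\tilde w=\tilde\alpha_0\tilde\beta_1\tilde\alpha_1$, and suppose $\mathrm{letters}(\alpha_0)=\mathrm{letters}(\alpha_1)=\mathrm{letters}(\tilde\alpha_0)=\mathrm{letters}(\tilde\alpha_1)$ is a subset of $\Sigma$ of size $|\Sigma|-1$. Then $w\sim_k\tilde w$ if and only if $\alpha_i\sim_{k-1}\tilde\alpha_i$ for all $i\in\{0,1\}$.
   Context: $\mathrm{letters}(x)$ is the set of letters occurring in $x$. A word $u$ is a scattered factor of $w$ if $u$ is obtained from $w$ by deleting some letters (keeping order). For $k\in\mathbb{N}_0$, $u\sim_k v$ iff $u$ and $v$ have exactly the same scattered factors of length at most $k$. $\iota(w)$ is the largest $\ell$ such that every word of $\Sigma^\ell$ is a scattered factor of $w$. The arch factorization of $w$ is the unique factorization $w=\mathrm{ar}_1(w)\cdots\mathrm{ar}_\ell(w)\mathrm{re}(w)$ where each arch contains every letter of $\Sigma$ and its last letter occurs exactly once in it, and $\mathrm{re}(w)$ does not contain every letter of $\Sigma$; $\ell=\iota(w)$. With $w^R$ the reversal, $\mathrm{ra}_i(w)\coloneqq(\mathrm{ar}_{\iota(w)-i+1}(w^R))^R$ and $\mathrm{er}(w)\coloneqq(\mathrm{re}(w^R))^R$. When $\iota(w)=1$ the $\alpha$-$\beta$-factorization is $w=\alpha_0\beta_1\alpha_1$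 with $\mathrm{ar}_1(w)=\alpha_0\beta_1$, $\mathrm{ra}_1(w)=\beta_1\alpha_1$, $\alpha_0=\mathrm{er}(w)$, $\alpha_1=\mathrm{re}(w)$. -}

module Defs where

open import Data.Nat using (ℕ; suc; _≤_)
open import Data.Fin using (Fin)
open import Data.Fin.Subset using (Subset; ⊥; _∪_; ⁅_⁆)
open import Data.List using (List; []; _∷_; _++_; [_]; length; reverse)
open import Data.List.Membership.Propositional using (_∈_; _∉_)
open import Data.List.Relation.Binary.Sublist.Propositional using (_⊆_)
open import Data.Product using (Σ; _×_; ∃; ∃-syntax)
open import Relation.Binary.PropositionalEquality using (_≡_)
open import Relation.Nullary using (¬_)
open import Function.Bundles using (_⇔_)

Word : ℕ → Set
Word σ = List (Fin σ)

letters : ∀ {σ} → Word σ → Subset σ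
letters []       = ⊥
letters (x ∷ xs) = ⁅ x ⁆ ∪ letters xs

ScatFactor : ∀ {σ} → Word σ → Word σ → Set
ScatFactor u w = u ⊆ w

_∼[_]_ : ∀ {σ} → Word σ → ℕ → Word σ → Set
u ∼[ k ] v = ∀ x → length x ≤ k → (ScatFactor x u ⇔ ScatFactor x v)

Universal : ∀ {σ} → ℕ → Word σ → Set
Universal ℓ w = ∀ u → length u ≡ ℓ → ScatFactor u w

HasIota : ∀ {σ} → Word σ → ℕ → Set
HasIota w ℓ = Universal ℓ w × (∀ m → Universal m w → m ≤ ℓ)

Complete : ∀ {σ} → Word σ → Set
Complete {σ} a = ∀ (x : Fin σ) → x ∈ a

IsArch : ∀ {σ} → Word σ → Set
IsArch a = Complete a × ∃[ a' ] ∃[ x ] (a ≡ a' ++ [ x ] × x ∉ a')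

ArchFact1 : ∀ {σ} → Word σ → (ar re : Word σ) → Set
ArchFact1 w ar re = w ≡ ar ++ re × IsArch ar × ¬ Complete re

-- α-β-factorization w = α₀ β₁ α₁ (for ι(w) = 1):
-- ar₁(w) = α₀β₁, α₁ = re(w), ra₁(w) = β₁α₁ = (ar₁(wᴿ))ᴿ, α₀ = er(w) = (re(wᴿ))ᴿ
ABFact : ∀ {σ} → Word σ → (α₀ β₁ α₁ : Word σ) → Set
ABFact w α₀ β₁ α₁ =
  w ≡ α₀ ++ β₁ ++ α₁ ×
  ArchFact1 w (α₀ ++ β₁) α₁ ×
  ArchFact1 (reverse w) (reverse (β₁ ++ α₁)) (reverse α₀)

-- With ι(w) = 1 and α₀, α₁ missing exactly one letter a, the middle factor β₁ is forced to
-- be the single letter a, so w = α₀ a α₁ where a is absent from both sides. A scattered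
-- factor of length ≤ k + 1 of such a word either uses the separator a, and then splits into
-- factors of length ≤ k of α₀ and α₁, or avoids it; in the latter case its last (resp.
-- first) letter can be moved across the separator, since α₀ and α₁ (and the corresponding
-- factors of w̃) have the same letters. Conversely, appending a to a factor of α₀ (resp.
-- prepending it to a factor of α₁) pins that factor to the left (resp. right) of the
-- separator of w̃.
module Submission where

open import Defs
open import Data.Nat using (ℕ; suc; _∸_; _≤_; _<_; z≤n; s≤s; s≤s⁻¹)
open import Data.Nat.Properties using (≤-trans; <-irrefl; m∸[m∸n]≡n; module ≤-Reasoning)
open import Data.Fin using (Fin; _≟_)
open import Data.Fin.Subset using (Subset; ∣_∣; ∁; _-_; ⁅_⁆)
  renaming (_∈_ to _∈ₛ_; _∉_ to _∉ₛ_)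
open import Data.Fin.Subset.Properties
  using (∉⊥; x∈⁅x⁆; x∈⁅y⁆⇒x≡y; p⊆p∪q; q⊆p∪q; x∈p∪q⁻; x∉p⇒x∈∁p; x∈p∧x≢y⇒x∈p-y;
         x∈p⇒∣p-x∣<∣p∣; ∣∁p∣≡n∸∣p∣)
open import Data.List using (List; []; _∷_; _++_; [_]; length; reverse)
open import Data.List.Properties
  using (∷-injectiveˡ; ∷-injectiveʳ; ++-identityʳ; length-++-≤ˡ; length-++-≤ʳ;
         length-++-sucʳ; length-++-comm; unfold-reverse; ∷ʳ-injective)
open import Data.List.Reverse using (reverseView; []; _∶_∶ʳ_)
open import Data.List.Membership.Propositional using (_∈_; _∉_)
open import Data.List.Membership.Propositional.Properties using (∈-++⁺ʳ)
open import Data.List.Relation.Unary.Any using (here; there)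
open import Data.List.Relation.Unary.Any.Properties using (reverse⁺)
open import Data.List.Relation.Binary.Subset.Propositional using () renaming (_⊆_ to _⊆ˢ_)
open import Data.List.Relation.Binary.Sublist.Propositional
  using (_⊆_; []; _∷_; _∷ʳ_; minimum; from∈; lookup; ⊆-refl; ⊆-trans; ⊆-reflexive)
open import Data.List.Relation.Binary.Sublist.Propositional.Properties
  using (++⁺; ++⁺ʳ; ∷⁻; ∷ˡ⁻)
open import Data.Product using (_×_; _,_; proj₁; proj₂; ∃-syntax; ∃₂)
open import Data.Sum using (inj₁; inj₂)
open import Data.Empty using (⊥-elim)
open import Relation.Nullary using (yes; no)
open import Relation.Binary.PropositionalEquality using (_≡_; refl; sym; trans; cong; subst)
open import Function using (_∘_)
open import Function.Bundles using (_⇔_; mk⇔; Equivalence)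

private
  variable
    A : Set
    σ k : ℕ
    a : A

∈⇒∈letters : ∀ {z : Fin σ} (xs : Word σ) → z ∈ xs → z ∈ₛ letters xs
∈⇒∈letters (x ∷ xs) (here refl) = p⊆p∪q (letters xs) (x∈⁅x⁆ x)
∈⇒∈letters (x ∷ xs) (there z∈xs) = q⊆p∪q ⁅ x ⁆ (letters xs) (∈⇒∈letters xs z∈xs)

∈letters⇒∈ : ∀ {z : Fin σ} (xs : Word σ) → z ∈ₛ letters xs → z ∈ xs
∈letters⇒∈ [] z∈⊥ = ⊥-elim (∉⊥ z∈⊥)
∈letters⇒∈ (x ∷ xs) z∈ with x∈p∪q⁻ ⁅ x ⁆ (letters xs) z∈
... | inj₁ z∈⁅x⁆ = here (x∈⁅y⁆⇒x≡y x z∈⁅x⁆)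
... | inj₂ z∈xs = there (∈letters⇒∈ xs z∈xs)

letters-≡⇒⊆ : ∀ {u v : Word σ} → letters u ≡ letters v → u ⊆ˢ v
letters-≡⇒⊆ {u = u} {v} eq z∈u = ∈letters⇒∈ v (subst (_ ∈ₛ_) eq (∈⇒∈letters u z∈u))

∣p∣≡n∸1⇒∉-unique : ∀ {n} (p : Subset n) {x y : Fin n} →
  ∣ p ∣ ≡ n ∸ 1 → x ∉ₛ p → y ∉ₛ p → x ≡ y
∣p∣≡n∸1⇒∉-unique {suc n} p {x} {y} ∣p∣≡n x∉p y∉p with x ≟ y
... | yes x≡y = x≡y
... | no x≢y = ⊥-elim (<-irrefl refl 1<1)
  where
  open ≤-Reasoning
  y∈∁p-x : y ∈ₛ ∁ p - x
  y∈∁p-x = x∈p∧x≢y⇒x∈p-y (x∉p⇒x∈∁p y∉p) (x≢y ∘ sym)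
  1<1 : 1 < 1
  1<1 = begin-strict
    1                 <⟨ s≤s (≤-trans (s≤s z≤n) (x∈p⇒∣p-x∣<∣p∣ y∈∁p-x)) ⟩
    suc ∣ ∁ p - x ∣   ≤⟨ x∈p⇒∣p-x∣<∣p∣ (x∉p⇒x∈∁p x∉p) ⟩
    ∣ ∁ p ∣           ≡⟨ ∣∁p∣≡n∸∣p∣ p ⟩
    suc n ∸ ∣ p ∣     ≡⟨ cong (suc n ∸_) ∣p∣≡n ⟩
    suc n ∸ n         ≡⟨ m∸[m∸n]≡n {suc n} (s≤s z≤n) ⟩
    1                 ∎

∷ʳ-unique⇒∉-prefix : ∀ (α : List A) {c β a' x} → α ++ c ∷ β ≡ a' ++ [ x ] → x ∉ a' → x ∉ α
∷ʳ-unique⇒∉-prefix (_ ∷ [])    {a' = []} ()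
∷ʳ-unique⇒∉-prefix (_ ∷ _ ∷ _) {a' = []} ()
∷ʳ-unique⇒∉-prefix (_ ∷ α) {a' = _ ∷ _} eq x∉a' (here refl) = x∉a' (here (∷-injectiveˡ eq))
∷ʳ-unique⇒∉-prefix (_ ∷ α) {a' = _ ∷ _} eq x∉a' (there x∈α) =
  ∷ʳ-unique⇒∉-prefix α (∷-injectiveʳ eq) (x∉a' ∘ there) x∈α

∷ʳ-unique⇒suffix≡[] : ∀ (α : List A) {x β a'} → α ++ x ∷ β ≡ a' ++ [ x ] → x ∉ a' → β ≡ []
∷ʳ-unique⇒suffix≡[] []          {a' = []}    eq _    = ∷-injectiveʳ eq
∷ʳ-unique⇒suffix≡[] []          {a' = _ ∷ _} eq x∉a' = ⊥-elim (x∉a' (here (∷-injectiveˡ eq)))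
∷ʳ-unique⇒suffix≡[] (_ ∷ [])    {a' = []} ()
∷ʳ-unique⇒suffix≡[] (_ ∷ _ ∷ _) {a' = []} ()
∷ʳ-unique⇒suffix≡[] (_ ∷ α)     {a' = _ ∷ _} eq x∉a' =
  ∷ʳ-unique⇒suffix≡[] α (∷-injectiveʳ eq) (x∉a' ∘ there)

reverse-∷ʳ-unique⇒head∉ : ∀ {c : A} {γ b' y} → reverse (c ∷ γ) ≡ b' ++ [ y ] → y ∉ b' → c ∉ γ
reverse-∷ʳ-unique⇒head∉ {c = c} {γ} {b'} eq y∉b'
  with refl , refl ← ∷ʳ-injective (reverse γ) b' (trans (sym (unfold-reverse c γ)) eq)
  = y∉b' ∘ reverse⁺

ABFact⇒separator : ∀ {w α₀ β₁ α₁ : Word σ} → ABFact w α₀ β₁ α₁ →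
  letters α₀ ≡ letters α₁ → ∣ letters α₀ ∣ ≡ σ ∸ 1 →
  ∃[ a ] (β₁ ≡ [ a ] × a ∉ α₀ × a ∉ α₁)
ABFact⇒separator {α₀ = α₀} {[]} (_ , (_ , (α₀-complete , _) , α₁-incomplete) , _) α₀≈α₁ _ =
  ⊥-elim (α₁-incomplete λ z → letters-≡⇒⊆ α₀≈α₁ (subst (z ∈_) (++-identityʳ α₀) (α₀-complete z)))
ABFact⇒separator {α₀ = α₀} {c ∷ β} {α₁}
  (_ , (_ , (_ , a' , x , arch≡ , x∉a') , _) , (_ , (_ , b' , y , rarch≡ , y∉b') , _)) α₀≈α₁ ∣α₀∣ =
  c , cong (c ∷_) β≡[] , c∉α₀ , c∉α₁
  where
  c∉α₁ : c ∉ α₁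
  c∉α₁ = reverse-∷ʳ-unique⇒head∉ rarch≡ y∉b' ∘ ∈-++⁺ʳ β
  c∉α₀ : c ∉ α₀
  c∉α₀ = c∉α₁ ∘ letters-≡⇒⊆ α₀≈α₁
  x≡c : x ≡ c
  x≡c = ∣p∣≡n∸1⇒∉-unique (letters α₀) ∣α₀∣
    (∷ʳ-unique⇒∉-prefix α₀ arch≡ x∉a' ∘ ∈letters⇒∈ α₀) (c∉α₀ ∘ ∈letters⇒∈ α₀)
  β≡[] : β ≡ []
  β≡[] = ∷ʳ-unique⇒suffix≡[] α₀ (subst (λ z → α₀ ++ c ∷ β ≡ a' ++ [ z ]) x≡c arch≡)
    (subst (_∉ a') x≡c x∉a')

∷ʳ⊆⇒⊆-prefix : ∀ (x p : List A) {q} → x ++ [ a ] ⊆ p ++ a ∷ q → a ∉ q → x ⊆ p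
∷ʳ⊆⇒⊆-prefix []      p       _        _   = minimum p
∷ʳ⊆⇒⊆-prefix (_ ∷ x) []      s        a∉q = ⊥-elim (a∉q (lookup (∷⁻ s) (∈-++⁺ʳ x (here refl))))
∷ʳ⊆⇒⊆-prefix (b ∷ x) (c ∷ p) (_ ∷ʳ s) a∉q = c ∷ʳ ∷ʳ⊆⇒⊆-prefix (b ∷ x) p s a∉q
∷ʳ⊆⇒⊆-prefix (_ ∷ x) (_ ∷ p) (e ∷ s)  a∉q = e ∷ ∷ʳ⊆⇒⊆-prefix x p s a∉q

∷⊆⇒⊆-suffix : ∀ (p : List A) {x q} → a ∷ x ⊆ p ++ a ∷ q → a ∉ p → x ⊆ q
∷⊆⇒⊆-suffix []      s          _   = ∷⁻ s
∷⊆⇒⊆-suffix (_ ∷ p) (_ ∷ʳ s)   a∉p = ∷⊆⇒⊆-suffix p s (a∉p ∘ there)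
∷⊆⇒⊆-suffix (_ ∷ p) (refl ∷ _) a∉p = ⊥-elim (a∉p (here refl))

⊆-++-split : ∀ (p : List A) {q x} → x ⊆ p ++ q → ∃₂ λ x₀ x₁ → x ≡ x₀ ++ x₁ × x₀ ⊆ p × x₁ ⊆ q
⊆-++-split []      s = [] , _ , refl , [] , s
⊆-++-split (c ∷ p) (_ ∷ʳ s) with x₀ , x₁ , refl , s₀ , s₁ ← ⊆-++-split p s
  = x₀ , x₁ , refl , c ∷ʳ s₀ , s₁
⊆-++-split (c ∷ p) (e ∷ s) with x₀ , x₁ , refl , s₀ , s₁ ← ⊆-++-split p s
  = _ ∷ x₀ , x₁ , refl , e ∷ s₀ , s₁

length-++-≤⁻ : ∀ (xs : List A) {ys n} → length (xs ++ ys) ≤ n → length xs ≤ n × length ys ≤ n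
length-++-≤⁻ xs {ys} l = ≤-trans (length-++-≤ˡ xs) l , ≤-trans (length-++-≤ʳ ys {xs}) l

length-∷ʳ : ∀ (xs : List A) x → length (xs ++ [ x ]) ≡ suc (length xs)
length-∷ʳ xs x = length-++-comm xs [ x ]

infix 4 _≼[_]_

_≼[_]_ : List A → ℕ → List A → Set
u ≼[ k ] v = ∀ x → length x ≤ k → x ⊆ u → x ⊆ v

∼⇒≼ : ∀ {u v : Word σ} → u ∼[ k ] v → u ≼[ k ] v
∼⇒≼ u∼v x l = Equivalence.to (u∼v x l)

∼⇒≽ : ∀ {u v : Word σ} → u ∼[ k ] v → v ≼[ k ] u
∼⇒≽ u∼v x l = Equivalence.from (u∼v x l)

≼×≽⇒∼ : ∀ {u v : Word σ} → u ≼[ k ] v → v ≼[ k ] u → u ∼[ k ] v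
≼×≽⇒∼ u≼v v≼u x l = mk⇔ (u≼v x l) (v≼u x l)

≼-extendʳ : ∀ {α γ δ : List A} → α ≼[ k ] γ → α ⊆ˢ δ → α ≼[ suc k ] γ ++ δ
≼-extendʳ {k = k} α≼γ α⊆δ x l s with reverseView x
... | [] = minimum _
... | x' ∶ _ ∶ʳ c =
  ++⁺ (α≼γ x' (s≤s⁻¹ (subst (_≤ suc k) (length-∷ʳ x' c) l)) (⊆-trans (++⁺ʳ [ c ] ⊆-refl) s))
      (from∈ (α⊆δ (lookup s (∈-++⁺ʳ x' (here refl)))))

≼-extendˡ : ∀ {α γ δ : List A} → α ≼[ k ] γ → α ⊆ˢ δ → α ≼[ suc k ] δ ++ γ
≼-extendˡ α≼γ α⊆δ []      _       _ = minimum _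
≼-extendˡ α≼γ α⊆δ (c ∷ x) (s≤s l) s = ++⁺ (from∈ (α⊆δ (lookup s (here refl)))) (α≼γ x l (∷ˡ⁻ s))

≼-++ : ∀ {α₀ α₁ γ₀ γ₁ : List A} → α₀ ≼[ k ] γ₀ → α₁ ≼[ k ] γ₁ → α₀ ⊆ˢ γ₁ → α₁ ⊆ˢ γ₀ →
  α₀ ++ α₁ ≼[ suc k ] γ₀ ++ γ₁
≼-++ {k = k} {α₀ = α₀} α₀≼γ₀ α₁≼γ₁ α₀⊆γ₁ α₁⊆γ₀ x l s with ⊆-++-split α₀ s
... | x₀ , [] , refl , s₀ , _ =
  ⊆-trans (⊆-reflexive (++-identityʳ x₀)) (≼-extendʳ α₀≼γ₀ α₀⊆γ₁ x₀ (proj₁ (length-++-≤⁻ x₀ l)) s₀)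
... | [] , x₁ , refl , _ , s₁ = ≼-extendˡ α₁≼γ₁ α₁⊆γ₀ x₁ l s₁
... | d ∷ x₀ , c ∷ x₁ , refl , s₀ , s₁ = ++⁺ (α₀≼γ₀ (d ∷ x₀) l₀ s₀) (α₁≼γ₁ (c ∷ x₁) l₁ s₁)
  where
  l₀ : length (d ∷ x₀) ≤ k
  l₀ = proj₁ (length-++-≤⁻ (d ∷ x₀) (s≤s⁻¹ (subst (_≤ suc k) (length-++-sucʳ (d ∷ x₀) c x₁) l)))
  l₁ : length (c ∷ x₁) ≤ k
  l₁ = proj₂ (length-++-≤⁻ x₀ (s≤s⁻¹ l))

≼-insert : ∀ {α₀ α₁ γ₀ γ₁ : List A} → α₀ ≼[ k ] γ₀ → α₁ ≼[ k ] γ₁ → α₀ ⊆ˢ γ₁ → α₁ ⊆ˢ γ₀ →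
  α₀ ++ a ∷ α₁ ≼[ suc k ] γ₀ ++ a ∷ γ₁
≼-insert {k = k} {a = a} {α₀} α₀≼γ₀ α₁≼γ₁ α₀⊆γ₁ α₁⊆γ₀ x l s with ⊆-++-split α₀ s
... | x₀ , x₁ , refl , s₀ , (_ ∷ʳ s₁) =
  ⊆-trans (≼-++ α₀≼γ₀ α₁≼γ₁ α₀⊆γ₁ α₁⊆γ₀ (x₀ ++ x₁) l (++⁺ s₀ s₁)) (++⁺ ⊆-refl (a ∷ʳ ⊆-refl))
... | x₀ , _ ∷ x₁ , refl , s₀ , (refl ∷ s₁) =
  ++⁺ (α₀≼γ₀ x₀ (proj₁ l₀₁) s₀) (refl ∷ α₁≼γ₁ x₁ (proj₂ l₀₁) s₁)
  where
  l₀₁ : length x₀ ≤ k × length x₁ ≤ k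
  l₀₁ = length-++-≤⁻ x₀ (s≤s⁻¹ (subst (_≤ suc k) (length-++-sucʳ x₀ a x₁) l))

≼-prefix : ∀ {α₀ α₁ γ₀ γ₁ : List A} → a ∉ γ₁ →
  α₀ ++ a ∷ α₁ ≼[ suc k ] γ₀ ++ a ∷ γ₁ → α₀ ≼[ k ] γ₀
≼-prefix {a = a} {k = k} {α₁ = α₁} {γ₀} a∉γ₁ α≼γ x l s =
  ∷ʳ⊆⇒⊆-prefix x γ₀ (α≼γ (x ++ [ a ]) (subst (_≤ suc k) (sym (length-∷ʳ x a)) (s≤s l))
                                       (++⁺ s (refl ∷ minimum α₁))) a∉γ₁

≼-suffix : ∀ {α₀ α₁ γ₀ γ₁ : List A} → a ∉ γ₀ →
  α₀ ++ a ∷ α₁ ≼[ suc k ] γ₀ ++ a ∷ γ₁ → α₁ ≼[ k ] γ₁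
≼-suffix {a = a} {α₀ = α₀} {γ₀ = γ₀} a∉γ₀ α≼γ x l s =
  ∷⊆⇒⊆-suffix γ₀ (α≼γ (a ∷ x) (s≤s l) (++⁺ (minimum α₀) (refl ∷ s))) a∉γ₀

∼-separator : ∀ {a : Fin σ} {α₀ α₁ γ₀ γ₁} →
  a ∉ α₀ → a ∉ α₁ → a ∉ γ₀ → a ∉ γ₁ →
  α₀ ⊆ˢ γ₁ → α₁ ⊆ˢ γ₀ → γ₀ ⊆ˢ α₁ → γ₁ ⊆ˢ α₀ →
  (α₀ ++ a ∷ α₁) ∼[ suc k ] (γ₀ ++ a ∷ γ₁) ⇔ (α₀ ∼[ k ] γ₀ × α₁ ∼[ k ] γ₁)
∼-separator a∉α₀ a∉α₁ a∉γ₀ a∉γ₁ α₀⊆γ₁ α₁⊆γ₀ γ₀⊆α₁ γ₁⊆α₀ = mk⇔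
  (λ α∼γ → ≼×≽⇒∼ (≼-prefix a∉γ₁ (∼⇒≼ α∼γ)) (≼-prefix a∉α₁ (∼⇒≽ α∼γ))
         , ≼×≽⇒∼ (≼-suffix a∉γ₀ (∼⇒≼ α∼γ)) (≼-suffix a∉α₀ (∼⇒≽ α∼γ)))
  (λ (α₀∼γ₀ , α₁∼γ₁) → ≼×≽⇒∼ (≼-insert (∼⇒≼ α₀∼γ₀) (∼⇒≼ α₁∼γ₁) α₀⊆γ₁ α₁⊆γ₀)
                             (≼-insert (∼⇒≽ α₀∼γ₀) (∼⇒≽ α₁∼γ₁) γ₀⊆α₁ γ₁⊆α₀))

proposition3 : ∀ (σ : ℕ) (k : ℕ) (w w̃ α₀ β₁ α₁ α̃₀ β̃₁ α̃₁ : Word σ) →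
    HasIota w 1 → HasIota w̃ 1 →
    ABFact w α₀ β₁ α₁ → ABFact w̃ α̃₀ β̃₁ α̃₁ →
    letters α₀ ≡ letters α₁ → letters α₁ ≡ letters α̃₀ → letters α̃₀ ≡ letters α̃₁ →
    ∣ letters α₀ ∣ ≡ σ ∸ 1 →
    (w ∼[ suc k ] w̃ ⇔ (α₀ ∼[ k ] α̃₀ × α₁ ∼[ k ] α̃₁))
proposition3 σ k w w̃ α₀ β₁ α₁ α̃₀ β̃₁ α̃₁ _ _ ab@(refl , _) ab̃@(refl , _) α₀≈α₁ α₁≈α̃₀ α̃₀≈α̃₁ ∣α₀∣
  using α₀≈α̃₀ ← trans α₀≈α₁ α₁≈α̃₀
  with a , refl , a∉α₀ , a∉α₁ ← ABFact⇒separator {β₁ = β₁} ab α₀≈α₁ ∣α₀∣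
     | b , refl , b∉α̃₀ , _    ← ABFact⇒separator {β₁ = β̃₁} ab̃ α̃₀≈α̃₁
                                                  (trans (cong ∣_∣ (sym α₀≈α̃₀)) ∣α₀∣)
  with refl ← ∣p∣≡n∸1⇒∉-unique (letters α₀) ∣α₀∣ (a∉α₀ ∘ ∈letters⇒∈ α₀)
                (b∉α̃₀ ∘ letters-≡⇒⊆ α₀≈α̃₀ ∘ ∈letters⇒∈ α₀)
  = ∼-separator a∉α₀ a∉α₁ (a∉α₀ ∘ α̃₀⊆α₀) (a∉α₀ ∘ α̃₁⊆α₀) α₀⊆α̃₁ α₁⊆α̃₀ α̃₀⊆α₁ α̃₁⊆α₀
  where
  α₀≈α̃₁ : letters α₀ ≡ letters α̃₁
  α₀≈α̃₁ = trans α₀≈α̃₀ α̃₀≈α̃₁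
  α̃₀⊆α₀ : α̃₀ ⊆ˢ α₀
  α̃₀⊆α₀ = letters-≡⇒⊆ (sym α₀≈α̃₀)
  α₀⊆α̃₁ : α₀ ⊆ˢ α̃₁
  α₀⊆α̃₁ = letters-≡⇒⊆ α₀≈α̃₁
  α̃₁⊆α₀ : α̃₁ ⊆ˢ α₀
  α̃₁⊆α₀ = letters-≡⇒⊆ (sym α₀≈α̃₁)
  α₁⊆α̃₀ : α₁ ⊆ˢ α̃₀
  α₁⊆α̃₀ = letters-≡⇒⊆ α₁≈α̃₀
  α̃₀⊆α₁ : α̃₀ ⊆ˢ α₁
  α̃₀⊆α₁ = letters-≡⇒⊆ (sym α₁≈α̃₀)
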